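{- Let $x=(x_j)_{j\in\mathbb{Z}}\in\{1,2,3\}^{\mathbb{Z}}$ be a sequence with Markov value $m(x)<3.938776241990046$. Suppose that for some $i\in\mathbb{Z}$ one has $x_{i-9}\dots x_i=1121211333$ and $x_{i+1}\dots x_{i+10}=1112121133$. Then $x_{i-15}\dots x_i=1133311121211333$, $x_{i+1}\dots x_{i+11}=11121211333$ and $x_{i+12}\dots x_{i+21}=1112121133$, so that the same hypothesis holds with $i$ replaced by $i+11$. Consequently, $$x_{i-15}\dots x_i=1133311121211333\quad\text{and}\quad x_{i+11k+1}\dots x_{i+11k+11}=11121211333\ \text{ for all } k\ge 0,$$ i.e. $x=\dots1133311121211333^{*}\overline{11121211333}$ with $x_i$ at the starred position.
   Context: For $\underline{a}=(a_j)_{j\in\mathbb{Z}}\in\{1,2,3,\dots\}^{\mathbb{Z}}$ and $k\in\mathbb{Z}$, $\lambda_k(\underline{a})=[a_k;a_{k-1},a_{k-2},\dots]+[0;a_{k+1},a_{k+2},\dots]$ and $m(\underline{a})=\sup_{k}\lambda_k(\underline{a})$ (Markov value). An overline at the right end of a string denotes infinite periodic repetition to the right. -}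

module Defs where

open import Data.Nat as ℕ using (ℕ; zero; suc; _≤_; _<_; _^_)
open import Data.Integer as ℤ using (ℤ; +_)
open import Data.List using (List; []; _∷_; map; upTo)
open import Data.Product using (_×_; _,_; Σ; ∃)
open import Data.Unit using (⊤)
open import Relation.Binary.PropositionalEquality using (_≡_)

Seq : Set
Seq = ℤ → ℕ

In123 : Seq → Set
In123 x = ∀ (j : ℤ) → 1 ≤ x j × x j ≤ 3

-- Finite continued fraction [a0; a1, ..., am] as a pair (numerator , denominator),
-- via the standard convergent recursion. cf [] = (1 , 0) plays the role of ∞.
cf : List ℕ → ℕ × ℕ
cf [] = 1 , 0
cf (a ∷ r) with cf r
... | p , q = a ℕ.* p ℕ.+ q , p

-- Even-order convergent of [x_k; x_{k-1}, x_{k-2}, ...]:  [x_k; x_{k-1}, ..., x_{k-2n}]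
leftConv : Seq → ℤ → ℕ → ℕ × ℕ
leftConv x k n = cf (map (λ j → x (k ℤ.- + j)) (upTo (suc (2 ℕ.* n))))

-- Even-order convergent of [0; x_{k+1}, x_{k+2}, ...]:  [0; x_{k+1}, ..., x_{k+2n}]
rightConv : Seq → ℤ → ℕ → ℕ × ℕ
rightConv x k n = cf (0 ∷ map (λ j → x (k ℤ.+ + suc j)) (upTo (2 ℕ.* n)))

-- "lowerλ x k n ≤ P/Q": the n-th lower approximation
--   [x_k; x_{k-1},...,x_{k-2n}] + [0; x_{k+1},...,x_{k+2n}]
-- of λ_k(x) is ≤ P/Q (cross-multiplied; all denominators are positive).
-- Even convergents are lower bounds increasing to the value, so
-- λ_k(x) = sup_n lowerλ x k n.
LowerApproxLe : Seq → ℤ → ℕ → ℕ → ℕ → Set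
LowerApproxLe x k n P Q with leftConv x k n | rightConv x k n
... | p₁ , q₁ | p₂ , q₂ = (p₁ ℕ.* q₂ ℕ.+ p₂ ℕ.* q₁) ℕ.* Q ≤ P ℕ.* (q₁ ℕ.* q₂)

-- m(x) < A/B  (B > 0): there is a rational P/Q < A/B with λ_k(x) ≤ P/Q for all k,
-- i.e. every lower approximation of every λ_k is ≤ P/Q.
MarkovLt : Seq → ℕ → ℕ → Set
MarkovLt x A B =
  Σ ℕ λ P → Σ ℕ λ Q → (0 < Q) × (P ℕ.* B < A ℕ.* Q) ×
    (∀ (k : ℤ) (n : ℕ) → LowerApproxLe x k n P Q)

cNum : ℕ
cNum = 3938776241990046

cDen : ℕ
cDen = 10 ^ 15

MatchAt : Seq → ℤ → List ℕ → Set
MatchAt x s [] = ⊤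
MatchAt x s (a ∷ w) = (x s ≡ a) × MatchAt x (ℤ.suc s) w

{-# OPTIONS --safe #-}
module Submission where

-- λ_k(x) is at least the sum of the even convergents [x_k; …, x_{k-2n}] + [0; x_{k+1}, …, x_{k+2n}].
-- As [a₀; a₁, …] increases in a₀ and decreases in its tail, over digits confined to intervals the
-- continued fraction is smallest when the digits alternate between lower and upper ends.  So once
-- some digits around i are known and the others are only known to lie in {1,2,3}, this gives a
-- computable lower bound for λ_{i+c}(x); if it reaches the constant, the configuration is impossible.
-- A finite certificate, checked by evaluation, combines such exclusions with case splits to force
-- x_{i-15} … x_{i+21} digit by digit.  That word contains the hypothesis shifted by 11, so induction
-- gives the periodic tail.

open import Defs
open import Data.Nat as ℕ using (ℕ; zero; suc; _+_; _*_; _≤_; _<_; z≤n; s≤s)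
import Data.Nat.Properties as ℕₚ
open import Data.Nat.Tactic.RingSolver using (solve-∀)
open import Data.Integer as ℤ using (ℤ; +_; -[1+_])
import Data.Integer.Properties as ℤₚ
open import Algebra.Properties.CommutativeSemigroup ℕₚ.*-commutativeSemigroup using (xy∙z≈xz∙y)
open import Algebra.Properties.CommutativeSemigroup ℤₚ.+-commutativeSemigroup using (x∙yz≈y∙xz)
open import Data.List using (List; []; _∷_; map; upTo; applyUpTo; _++_)
open import Data.List.Relation.Unary.All as All using (All; []; _∷_)
import Data.List.Relation.Unary.All.Properties as All
open import Data.List.Relation.Binary.Pointwise using (Pointwise; []; _∷_)
open import Data.Product using (_×_; _,_; proj₁; proj₂)
import Data.Product.Properties as Product
open import Data.Sum using (_⊎_; inj₁; inj₂; [_,_]′)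
open import Data.Empty using (⊥; ⊥-elim)
open import Data.Unit using (⊤)
open import Function using (_∘_; id)
open import Relation.Binary.Definitions using (Decidable; DecidableEquality)
open import Relation.Binary.PropositionalEquality
open import Relation.Nullary using (¬_; Dec; yes; no)
open import Relation.Nullary.Decidable using (True; toWitness; _×-dec_)

Fraction : Set
Fraction = ℕ × ℕ

infix 4 _≤F_
_≤F_ : Fraction → Fraction → Set
(p , q) ≤F (p′ , q′) = p * q′ ≤ p′ * q

_≤F?_ : Decidable _≤F_
(p , q) ≤F? (p′ , q′) = p * q′ ℕ.≤? p′ * q

infixl 6 _+F_
_+F_ : Fraction → Fraction → Fraction
(p , q) +F (p′ , q′) = p * q′ + p′ * q , q * q′

≤F-trans : ∀ {x y z} → 0 < proj₂ y → x ≤F y → y ≤F z → x ≤F z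
≤F-trans {a , b} {c , d} {e , f} d>0 ad≤cb cf≤ed =
  ℕₚ.*-cancelʳ-≤ (a * f) (e * b) d {{ℕ.>-nonZero d>0}} (begin
    a * f * d ≡⟨ xy∙z≈xz∙y a f d ⟩
    a * d * f ≤⟨ ℕₚ.*-monoˡ-≤ f ad≤cb ⟩
    c * b * f ≡⟨ xy∙z≈xz∙y c b f ⟩
    c * f * b ≤⟨ ℕₚ.*-monoˡ-≤ b cf≤ed ⟩
    e * d * b ≡⟨ xy∙z≈xz∙y e d b ⟩
    e * b * d ∎)
  where open ℕₚ.≤-Reasoning

+F-mono-≤F : ∀ {x x′ y y′} → x ≤F x′ → y ≤F y′ → x +F y ≤F x′ +F y′
+F-mono-≤F {a , b} {a′ , b′} {c , d} {c′ , d′} ab′≤a′b cd′≤c′d = begin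
  (a * d + c * b) * (b′ * d′)           ≡⟨ expand a b′ d d′ c b ⟩
  a * b′ * (d * d′) + c * d′ * (b * b′) ≤⟨ ℕₚ.+-mono-≤ (ℕₚ.*-monoˡ-≤ (d * d′) ab′≤a′b)
                                                       (ℕₚ.*-monoˡ-≤ (b * b′) cd′≤c′d) ⟩
  a′ * b * (d * d′) + c′ * d * (b * b′) ≡⟨ collect a′ b d d′ c′ b′ ⟩
  (a′ * d′ + c′ * b′) * (b * d)         ∎
  where
  open ℕₚ.≤-Reasoning
  expand : ∀ a b′ d d′ c b → (a * d + c * b) * (b′ * d′) ≡ a * b′ * (d * d′) + c * d′ * (b * b′)
  expand = solve-∀
  collect : ∀ a′ b d d′ c′ b′ → a′ * b * (d * d′) + c′ * d * (b * b′) ≡ (a′ * d′ + c′ * b′) * (b * d)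
  collect = solve-∀

cf-∷-mono : ∀ {l a r r′} → l ≤ a → cf r ≤F cf r′ → cf (l ∷ r′) ≤F cf (a ∷ r)
cf-∷-mono {l} {a} {r} {r′} l≤a pq′≤p′q = begin
  (l * p′ + q′) * p     ≡⟨ expand l p′ q′ p ⟩
  l * (p′ * p) + p * q′ ≤⟨ ℕₚ.+-mono-≤ (ℕₚ.*-monoˡ-≤ (p′ * p) l≤a) pq′≤p′q ⟩
  a * (p′ * p) + p′ * q ≡⟨ collect a p′ p q ⟩
  (a * p + q) * p′      ∎
  where
  open ℕₚ.≤-Reasoning
  p = proj₁ (cf r)
  q = proj₂ (cf r)
  p′ = proj₁ (cf r′)
  q′ = proj₂ (cf r′)
  expand : ∀ l p′ q′ p → (l * p′ + q′) * p ≡ l * (p′ * p) + p * q′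
  expand = solve-∀
  collect : ∀ a p′ p q → a * (p′ * p) + p′ * q ≡ (a * p + q) * p′
  collect = solve-∀

Interval : Set
Interval = ℕ × ℕ

infix 4 _∈ᵢ_
_∈ᵢ_ : ℕ → Interval → Set
a ∈ᵢ (l , h) = l ≤ a × a ≤ h

minimizer maximizer : List Interval → List ℕ
minimizer [] = []
minimizer ((l , _) ∷ Is) = l ∷ maximizer Is
maximizer [] = []
maximizer ((_ , h) ∷ Is) = h ∷ minimizer Is

cf-minimizer-≤F : ∀ {as Is} → Pointwise _∈ᵢ_ as Is → cf (minimizer Is) ≤F cf as
cf-maximizer-≥F : ∀ {as Is} → Pointwise _∈ᵢ_ as Is → cf as ≤F cf (maximizer Is)
cf-minimizer-≤F [] = z≤n
cf-minimizer-≤F {_ ∷ as} {_ ∷ Is} ((l≤a , _) ∷ as∈Is) =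
  cf-∷-mono {r = as} {maximizer Is} l≤a (cf-maximizer-≥F as∈Is)
cf-maximizer-≥F [] = z≤n
cf-maximizer-≥F {_ ∷ as} {_ ∷ Is} ((_ , a≤h) ∷ as∈Is) =
  cf-∷-mono {r = minimizer Is} {as} a≤h (cf-minimizer-≤F as∈Is)

cf-numerator-positive : ∀ {as} → All (0 <_) as → 0 < proj₁ (cf as)
cf-numerator-positive [] = s≤s z≤n
cf-numerator-positive {a ∷ as} (a>0 ∷ as>0) =
  ℕₚ.≤-trans (ℕₚ.*-mono-≤ a>0 (cf-numerator-positive as>0)) (ℕₚ.m≤m+n _ (proj₂ (cf as)))

cf-denominator-positive : ∀ a {as} → All (0 <_) as → 0 < proj₂ (cf (a ∷ as))
cf-denominator-positive _ = cf-numerator-positive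

pointwise-map : ∀ {A B C : Set} {R : B → C → Set} {f : A → B} {g : A → C} →
                (∀ j → R (f j) (g j)) → ∀ js → Pointwise R (map f js) (map g js)
pointwise-map f∼g [] = []
pointwise-map f∼g (j ∷ js) = f∼g j ∷ pointwise-map f∼g js

markov-denominator-positive : ∀ {x} → In123 x → ∀ k n →
                              0 < proj₂ (leftConv x k n +F rightConv x k n)
markov-denominator-positive {x} x∈ k n =
  ℕₚ.*-mono-≤
    (cf-denominator-positive (x k) (digits-positive (λ j → k ℤ.- + j) (applyUpTo suc (2 * n))))
    (cf-denominator-positive 0 (digits-positive (λ j → k ℤ.+ + suc j) (upTo (2 * n))))
  where
  digits-positive : ∀ (f : ℕ → ℤ) js → All (0 <_) (map (x ∘ f) js)
  digits-positive f js = All.map⁺ (All.universal (λ _ → proj₁ (x∈ _)) js)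

digit-cases : ∀ {a} → 1 ≤ a × a ≤ 3 → a ≡ 1 ⊎ a ≡ 2 ⊎ a ≡ 3
digit-cases {1} _ = inj₁ refl
digit-cases {2} _ = inj₂ (inj₁ refl)
digit-cases {3} _ = inj₂ (inj₂ refl)
digit-cases {suc (suc (suc (suc _)))} (_ , s≤s (s≤s (s≤s ())))

Facts : Set
Facts = List (ℤ × ℕ)

Holds : Seq → ℤ → ℤ × ℕ → Set
Holds x i (c , v) = x (i ℤ.+ c) ≡ v

range : Facts → ℤ → Interval
range [] c = 1 , 3
range ((d , v) ∷ ks) c with c ℤ.≟ d
... | yes _ = v , v
... | no _ = range ks c

_≟ᵢ_ : DecidableEquality Interval
_≟ᵢ_ = Product.≡-dec ℕ._≟_ ℕ._≟_

Pinned : Facts → ℤ → List ℕ → Set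
Pinned ks s [] = ⊤
Pinned ks s (a ∷ w) = True (range ks s ≟ᵢ (a , a)) × Pinned ks (ℤ.suc s) w

placed : ℤ → List ℕ → Facts
placed s [] = []
placed s (a ∷ w) = (s , a) ∷ placed (ℤ.suc s) w

+-sucʳ : ∀ i s → i ℤ.+ ℤ.suc s ≡ ℤ.suc (i ℤ.+ s)
+-sucʳ i s = x∙yz≈y∙xz i (+ 1) s

module _ {x : Seq} {i : ℤ} where

  matchAt⇒placed : ∀ s w → MatchAt x (i ℤ.+ s) w → All (Holds x i) (placed s w)
  matchAt⇒placed s [] _ = []
  matchAt⇒placed s (a ∷ w) (x≡a , m) =
    x≡a ∷ matchAt⇒placed (ℤ.suc s) w (subst (λ k → MatchAt x k w) (sym (+-sucʳ i s)) m)

leftBox : Facts → ℤ → ℕ → List Interval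
leftBox ks c n = map (λ j → range ks (c ℤ.- + j)) (upTo (suc (2 * n)))

rightBox : Facts → ℤ → ℕ → List Interval
rightBox ks c n = (0 , 0) ∷ map (λ j → range ks (c ℤ.+ + suc j)) (upTo (2 * n))

lowerBound : Facts → ℤ → ℕ → Fraction
lowerBound ks c n = cf (minimizer (leftBox ks c n)) +F cf (minimizer (rightBox ks c n))

Exceeds : Fraction → Facts → ℤ → ℕ → Set
Exceeds r ks c n = r ≤F lowerBound ks c n × 0 < proj₂ (lowerBound ks c n)

exceeds? : ∀ r ks c n → Dec (Exceeds r ks c n)
exceeds? r ks c n = r ≤F? lowerBound ks c n ×-dec 0 ℕ.<? proj₂ (lowerBound ks c n)

data Refutation : Set where
  exceeds : ℤ → ℕ → Refutation
  split : ℤ → Refutation → Refutation → Refutation → Refutation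

Refutes : Fraction → Facts → Refutation → Set
Refutes r ks (exceeds c n) = True (exceeds? r ks c n)
Refutes r ks (split c t₁ t₂ t₃) =
  Refutes r ((c , 1) ∷ ks) t₁ × Refutes r ((c , 2) ∷ ks) t₂ × Refutes r ((c , 3) ∷ ks) t₃

data Deduction : Set where
  done : Deduction
  force : ℤ → ℕ → Refutation → Refutation → Deduction → Deduction

Forces : Fraction → Facts → Deduction → Set
Forces r ks done = ⊤
Forces r ks (force c 1 t t′ d) =
  Refutes r ((c , 2) ∷ ks) t × Refutes r ((c , 3) ∷ ks) t′ × Forces r ((c , 1) ∷ ks) d
Forces r ks (force c 2 t t′ d) =
  Refutes r ((c , 1) ∷ ks) t × Refutes r ((c , 3) ∷ ks) t′ × Forces r ((c , 2) ∷ ks) d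
Forces r ks (force c 3 t t′ d) =
  Refutes r ((c , 1) ∷ ks) t × Refutes r ((c , 2) ∷ ks) t′ × Forces r ((c , 3) ∷ ks) d
Forces r ks (force _ _ _ _ _) = ⊥

deduced : Facts → Deduction → Facts
deduced ks done = ks
deduced ks (force c v _ _ d) = deduced ((c , v) ∷ ks) d

module _ {x : Seq} (x∈ : In123 x) {i : ℤ} where

  range-sound : ∀ {ks} → All (Holds x i) ks → ∀ c → x (i ℤ.+ c) ∈ᵢ range ks c
  range-sound [] c = x∈ (i ℤ.+ c)
  range-sound {(d , v) ∷ ks} (x≡v ∷ hs) c with c ℤ.≟ d
  ... | yes refl = ℕₚ.≤-reflexive (sym x≡v) , ℕₚ.≤-reflexive x≡v
  ... | no _ = range-sound hs c

  pinned⇒matchAt : ∀ {ks} → All (Holds x i) ks → ∀ s w → Pinned ks s w → MatchAt x (i ℤ.+ s) w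
  pinned⇒matchAt hs s [] _ = _
  pinned⇒matchAt {ks} hs s (a ∷ w) (pinned , rest) =
    ℕₚ.≤-antisym (proj₂ x∈[a,a]) (proj₁ x∈[a,a]) ,
    subst (λ k → MatchAt x k w) (+-sucʳ i s) (pinned⇒matchAt hs (ℤ.suc s) w rest)
    where
    x∈[a,a] : x (i ℤ.+ s) ∈ᵢ (a , a)
    x∈[a,a] = subst (x (i ℤ.+ s) ∈ᵢ_)
                    (toWitness {a? = range ks s ≟ᵢ (a , a)} pinned)
                    (range-sound hs s)

  lowerBound-≤F : ∀ {ks} → All (Holds x i) ks → ∀ c n →
                  lowerBound ks c n ≤F leftConv x (i ℤ.+ c) n +F rightConv x (i ℤ.+ c) n
  lowerBound-≤F {ks} hs c n =
    +F-mono-≤F {cf (minimizer (leftBox ks c n))} {leftConv x (i ℤ.+ c) n}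
               {cf (minimizer (rightBox ks c n))} {rightConv x (i ℤ.+ c) n}
               (cf-minimizer-≤F left-window) (cf-minimizer-≤F right-window)
    where
    shifted : ∀ d → x (i ℤ.+ (c ℤ.+ d)) ∈ᵢ range ks (c ℤ.+ d) →
                    x (i ℤ.+ c ℤ.+ d) ∈ᵢ range ks (c ℤ.+ d)
    shifted d = subst (λ k → x k ∈ᵢ range ks (c ℤ.+ d)) (sym (ℤₚ.+-assoc i c d))
    left-window : Pointwise _∈ᵢ_ (map (λ j → x (i ℤ.+ c ℤ.- + j)) (upTo (suc (2 * n))))
                                 (leftBox ks c n)
    left-window = pointwise-map (λ j → shifted (ℤ.- + j) (range-sound hs (c ℤ.- + j)))
                                (upTo (suc (2 * n)))
    right-window : Pointwise _∈ᵢ_ (0 ∷ map (λ j → x (i ℤ.+ c ℤ.+ + suc j)) (upTo (2 * n)))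
                                  (rightBox ks c n)
    right-window =
      (z≤n , z≤n) ∷ pointwise-map (λ j → shifted (+ suc j) (range-sound hs (c ℤ.+ + suc j))) (upTo (2 * n))

  exceeds-absurd : ∀ {A B ks c n} → MarkovLt x A B → All (Holds x i) ks → ¬ Exceeds (A , B) ks c n
  exceeds-absurd {A} {B} {ks} {c} {n} (P , Q , _ , P/Q<A/B , λ≤P/Q) hs (A/B≤low , low>0) =
    ℕₚ.<⇒≱ P/Q<A/B A/B≤P/Q
    where
    low = lowerBound ks c n
    λₙ = leftConv x (i ℤ.+ c) n +F rightConv x (i ℤ.+ c) n
    A/B≤P/Q : (A , B) ≤F (P , Q)
    A/B≤P/Q = ≤F-trans {A , B} {low} {P , Q} low>0 A/B≤low
                (≤F-trans {low} {λₙ} {P , Q} (markov-denominator-positive x∈ (i ℤ.+ c) n)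
                          (lowerBound-≤F hs c n) (λ≤P/Q (i ℤ.+ c) n))

  module _ {A B : ℕ} (m<A/B : MarkovLt x A B) where

    refutes-absurd : ∀ {ks} → All (Holds x i) ks → ∀ t → ¬ Refutes (A , B) ks t
    refutes-absurd {ks} hs (exceeds c n) r =
      exceeds-absurd {A} {B} {c = c} {n} m<A/B hs (toWitness {a? = exceeds? (A , B) ks c n} r)
    refutes-absurd hs (split c t₁ t₂ t₃) (r₁ , r₂ , r₃) with digit-cases (x∈ (i ℤ.+ c))
    ... | inj₁ x≡1 = refutes-absurd (x≡1 ∷ hs) t₁ r₁
    ... | inj₂ (inj₁ x≡2) = refutes-absurd (x≡2 ∷ hs) t₂ r₂
    ... | inj₂ (inj₂ x≡3) = refutes-absurd (x≡3 ∷ hs) t₃ r₃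

    excluded : ∀ {ks c u} → All (Holds x i) ks → ∀ t → Refutes (A , B) ((c , u) ∷ ks) t →
               x (i ℤ.+ c) ≢ u
    excluded hs t r x≡u = refutes-absurd (x≡u ∷ hs) t r

    forces-sound : ∀ {ks} → All (Holds x i) ks → ∀ d → Forces (A , B) ks d →
                   All (Holds x i) (deduced ks d)
    forces-sound hs done _ = hs
    forces-sound hs (force c 1 t₂ t₃ d) (r₂ , r₃ , f) = forces-sound (x≡1 ∷ hs) d f
      where
      x≡1 : x (i ℤ.+ c) ≡ 1
      x≡1 = [ id , [ ⊥-elim ∘ excluded hs t₂ r₂ , ⊥-elim ∘ excluded hs t₃ r₃ ]′ ]′ (digit-cases (x∈ _))
    forces-sound hs (force c 2 t₁ t₃ d) (r₁ , r₃ , f) = forces-sound (x≡2 ∷ hs) d f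
      where
      x≡2 : x (i ℤ.+ c) ≡ 2
      x≡2 = [ ⊥-elim ∘ excluded hs t₁ r₁ , [ id , ⊥-elim ∘ excluded hs t₃ r₃ ]′ ]′ (digit-cases (x∈ _))
    forces-sound hs (force c 3 t₁ t₂ d) (r₁ , r₂ , f) = forces-sound (x≡3 ∷ hs) d f
      where
      x≡3 : x (i ℤ.+ c) ≡ 3
      x≡3 = [ ⊥-elim ∘ excluded hs t₁ r₁ , [ ⊥-elim ∘ excluded hs t₂ r₂ , id ]′ ]′ (digit-cases (x∈ _))

before : List ℕ
before = 1 ∷ 1 ∷ 2 ∷ 1 ∷ 2 ∷ 1 ∷ 1 ∷ 3 ∷ 3 ∷ 3 ∷ []

after : List ℕ
after = 1 ∷ 1 ∷ 1 ∷ 2 ∷ 1 ∷ 2 ∷ 1 ∷ 1 ∷ 3 ∷ 3 ∷ []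

longBefore : List ℕ
longBefore = 1 ∷ 1 ∷ 3 ∷ 3 ∷ 3 ∷ 1 ∷ 1 ∷ 1 ∷ 2 ∷ 1 ∷ 2 ∷ 1 ∷ 1 ∷ 3 ∷ 3 ∷ 3 ∷ []

period : List ℕ
period = 1 ∷ 1 ∷ 1 ∷ 2 ∷ 1 ∷ 2 ∷ 1 ∷ 1 ∷ 3 ∷ 3 ∷ 3 ∷ []

record Seed (x : Seq) (i : ℤ) : Set where
  constructor seed
  field
    before-i : MatchAt x (i ℤ.- + 9) before
    after-i : MatchAt x (i ℤ.+ + 1) after

seedFacts : Facts
seedFacts = placed -[1+ 8 ] before ++ placed (+ 1) after

-- Forces unfolds to a product of True's, so certificate-forces is accepted as soon as every check
-- in the certificate evaluates to yes.
certificate : Deduction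
certificate =
  force -[1+ 10 ] 3 (exceeds (+ 0) 6) (exceeds (+ 0) 7)
  (force -[1+ 9 ] 1 (exceeds (+ 0) 5) (exceeds (+ 0) 5)
  (force (+ 11) 3 (exceeds (+ 0) 6) (exceeds (+ 0) 6)
  (force -[1+ 11 ] 3 (exceeds -[1+ 10 ] 1) (exceeds -[1+ 10 ] 2)
  (force (+ 12) 1 (exceeds (+ 0) 6) (exceeds (+ 0) 6)
  (force (+ 13) 1 (exceeds (+ 11) 1) (exceeds (+ 11) 1)
  (force (+ 14) 1 (exceeds (+ 0) 7) (exceeds (+ 0) 7)
  (force (+ 15) 2 (exceeds (+ 0) 8) (exceeds (+ 11) 2)
  (force (+ 16) 1 (exceeds (+ 0) 8) (exceeds (+ 0) 8)
  (force -[1+ 13 ] 1 (exceeds (+ 0) 9) (exceeds (+ 0) 9)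
  (force -[1+ 12 ] 3 (exceeds (+ 0) 8) (exceeds (+ 0) 8)
  (force -[1+ 14 ] 1 (exceeds -[1+ 12 ] 1) (exceeds -[1+ 12 ] 1)
  (force (+ 17) 2 (exceeds (+ 0) 10) (exceeds (+ 11) 3)
  (force (+ 18) 1
     (split -[1+ 15 ]
       (exceeds -[1+ 10 ] 4)
       (split -[1+ 16 ]
         (split -[1+ 17 ]
           (exceeds -[1+ 10 ] 5)
           (split -[1+ 18 ] (exceeds (+ 0) 13) (exceeds -[1+ 10 ] 5) (exceeds -[1+ 10 ] 5))
           (exceeds -[1+ 17 ] 2))
         (exceeds -[1+ 10 ] 4)
         (exceeds -[1+ 10 ] 4))
       (exceeds (+ 0) 9))
     (split -[1+ 15 ] (exceeds -[1+ 10 ] 4) (exceeds (+ 0) 10) (exceeds (+ 0) 9))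
  (force (+ 19) 1 (exceeds (+ 11) 4) (exceeds (+ 11) 4)
  (force (+ 20) 3 (exceeds (+ 11) 5) (exceeds (+ 11) 5)
  (force (+ 21) 3
     (exceeds (+ 20) 1)
     (split (+ 22)
       (split (+ 23) (exceeds (+ 20) 2) (exceeds (+ 20) 3) (exceeds (+ 23) 2))
       (exceeds (+ 20) 2)
       (exceeds (+ 20) 2))
  done))))))))))))))))

certificate-forces : Forces (cNum , cDen) seedFacts certificate
certificate-forces = _

seed-facts : ∀ {x i} → Seed x i → All (Holds x i) seedFacts
seed-facts {x} {i} (seed m₁ m₂) =
  All.++⁺ (matchAt⇒placed {x} {i} -[1+ 8 ] before m₁) (matchAt⇒placed {x} {i} (+ 1) after m₂)

module _ {x : Seq} (x∈ : In123 x) (m<c : MarkovLt x cNum cDen) where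

  seed-reads : ∀ {i} → Seed x i → ∀ s w → Pinned (deduced seedFacts certificate) s w →
               MatchAt x (i ℤ.+ s) w
  -- The bound must be passed explicitly: inferred by unification against MarkovLt, checking this
  -- line exhausts memory.
  seed-reads {i} σ =
    pinned⇒matchAt x∈ {i} (forces-sound x∈ {i} {cNum} {cDen} m<c (seed-facts σ) certificate certificate-forces)

  seed-shift : ∀ {i} → Seed x i → Seed x (i ℤ.+ + 11)
  seed-shift {i} σ = seed
    (subst (λ k → MatchAt x k before) (sym (ℤₚ.+-assoc i (+ 11) -[1+ 8 ])) (seed-reads σ (+ 2) before _))
    (subst (λ k → MatchAt x k after) (sym (ℤₚ.+-assoc i (+ 11) (+ 1))) (seed-reads σ (+ 12) after _))

  seed-iterate : ∀ {i} → Seed x i → ∀ k → Seed x (i ℤ.+ + (11 * k))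
  seed-iterate {i} σ zero = subst (Seed x) (sym (ℤₚ.+-identityʳ i)) σ
  seed-iterate {i} σ (suc k) = subst (Seed x) shift (seed-shift (seed-iterate σ k))
    where
    shift : i ℤ.+ + (11 * k) ℤ.+ + 11 ≡ i ℤ.+ + (11 * suc k)
    shift = trans (ℤₚ.+-assoc i (+ (11 * k)) (+ 11))
                  (cong (λ m → i ℤ.+ + m) (trans (ℕₚ.+-comm (11 * k) 11) (sym (ℕₚ.*-suc 11 k))))

corollary2p29 : (x : Seq) → In123 x → MarkovLt x cNum cDen → (i : ℤ)
    → MatchAt x (i ℤ.- + 9) (1 ∷ 1 ∷ 2 ∷ 1 ∷ 2 ∷ 1 ∷ 1 ∷ 3 ∷ 3 ∷ 3 ∷ [])
    → MatchAt x (i ℤ.+ + 1) (1 ∷ 1 ∷ 1 ∷ 2 ∷ 1 ∷ 2 ∷ 1 ∷ 1 ∷ 3 ∷ 3 ∷ [])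
    → (MatchAt x (i ℤ.- + 15) (1 ∷ 1 ∷ 3 ∷ 3 ∷ 3 ∷ 1 ∷ 1 ∷ 1 ∷ 2 ∷ 1 ∷ 2 ∷ 1 ∷ 1 ∷ 3 ∷ 3 ∷ 3 ∷ [])
       × MatchAt x (i ℤ.+ + 1) (1 ∷ 1 ∷ 1 ∷ 2 ∷ 1 ∷ 2 ∷ 1 ∷ 1 ∷ 3 ∷ 3 ∷ 3 ∷ [])
       × MatchAt x (i ℤ.+ + 12) (1 ∷ 1 ∷ 1 ∷ 2 ∷ 1 ∷ 2 ∷ 1 ∷ 1 ∷ 3 ∷ 3 ∷ []))
      × ((k : ℕ) → MatchAt x (i ℤ.+ + (11 ℕ.* k ℕ.+ 1)) (1 ∷ 1 ∷ 1 ∷ 2 ∷ 1 ∷ 2 ∷ 1 ∷ 1 ∷ 3 ∷ 3 ∷ 3 ∷ []))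
corollary2p29 x x∈ m<c i m₁ m₂ =
  (reads σ -[1+ 14 ] longBefore _ , reads σ (+ 1) period _ , reads σ (+ 12) after _) ,
  λ k → subst (λ j → MatchAt x j period) (ℤₚ.+-assoc i (+ (11 * k)) (+ 1))
              (reads (seed-iterate x∈ m<c σ k) (+ 1) period _)
  where
  σ : Seed x i
  σ = seed m₁ m₂
  reads : ∀ {j} → Seed x j → ∀ s w → Pinned (deduced seedFacts certificate) s w → MatchAt x (j ℤ.+ s) w
  reads = seed-reads x∈ m<c
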